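{- For every $\mathsf{F}$-term $P^{\mathsf{F}}$ and every $\mathsf{T}$-term $P^{\mathsf{T}}$: $\mathrm{EqFFEL} \vdash P^{\mathsf{F}} = P^{\mathsf{F}} \wedge^{\bullet} \mathsf{F}$ and $\mathrm{EqFFEL} \vdash P^{\mathsf{T}} = P^{\mathsf{T}} \vee^{\bullet} \mathsf{T}$.
   Context: Let $A$ be a countable set of atoms; FEL-terms are $P ::= a \ (a\in A) \mid \mathsf{T} \mid \mathsf{F} \mid \neg P \mid (P \wedge^{\bullet} P) \mid (P \vee^{\bullet} P)$ (full left-sequential connectives). $\mathsf{T}$-terms: $P^{\mathsf{T}} ::= \mathsf{T} \mid a \vee^{\bullet} P^{\mathsf{T}}$; $\mathsf{F}$-terms: $P^{\mathsf{F}} ::= \mathsf{F} \mid a \wedge^{\bullet} P^{\mathsf{F}}$ ($a\in A$). $\mathrm{EqFFEL}$ is the set of equations: $\mathsf{F} = \neg\mathsf{T}$; $x \vee^{\bullet} y = \neg(\neg x \wedge^{\bullet} \neg y)$; $\neg\neg x = x$; $(x \wedge^{\bullet} y) \wedge^{\bullet} z = x \wedge^{\bullet} (y \wedge^{\bullet} z)$; $\mathsf{T} \wedge^{\bullet} x = x$; $x \wedge^{\bullet} \mathsf{T} = x$; $x \wedge^{\bullet} \mathsf{F} = \mathsf{F} \wedge^{\bullet} x$; $x \wedge^{\bullet} \mathsf{F} = \neg x \wedge^{\bullet} \mathsf{F}$; $(x \wedge^{\bullet} \mathsf{F}) \vee^{\bullet} y = (x \vee^{\bullet} \mathsf{T})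 \wedge^{\bullet} y$; $x \vee^{\bullet} (y \wedge^{\bullet} \mathsf{F}) = x \wedge^{\bullet} (y \vee^{\bullet} \mathsf{T})$. $\mathrm{EqFFEL}\vdash s=t$ denotes derivability by equational logic. -}

module Defs where

open import Data.Nat using (ℕ)

-- Atoms: a countable set A, represented by ℕ.
Atom : Set
Atom = ℕ

infixr 6 _∧●_
infixr 5 _∨●_
data Term : Set where
  atom  : Atom → Term
  𝐓     : Term
  𝐅     : Term
  ¬'_   : Term → Term
  _∧●_  : Term → Term → Term
  _∨●_  : Term → Term → Term

data IsTTerm : Term → Set where
  tT   : IsTTerm 𝐓
  tOr  : ∀ a {P} → IsTTerm P → IsTTerm (atom a ∨● P)

data IsFTerm : Term → Set where
  fF   : IsFTerm 𝐅
  fAnd : ∀ a {P} → IsFTerm P → IsFTerm (atom a ∧● P)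

-- Axioms are given as schemes (all substitution instances of the
-- variables x, y, z by terms); together with reflexivity, symmetry,
-- transitivity and congruence this is exactly equational-logic
-- derivability for closed terms.
infix 4 EqFFEL⊢_≈_
data EqFFEL⊢_≈_ : Term → Term → Set where
  ax-F      : EqFFEL⊢ 𝐅 ≈ ¬' 𝐓
  ax-or     : ∀ x y → EqFFEL⊢ x ∨● y ≈ ¬' (¬' x ∧● ¬' y)
  ax-negneg : ∀ x → EqFFEL⊢ ¬' ¬' x ≈ x
  ax-assoc  : ∀ x y z → EqFFEL⊢ (x ∧● y) ∧● z ≈ x ∧● (y ∧● z)
  ax-Tl     : ∀ x → EqFFEL⊢ 𝐓 ∧● x ≈ x
  ax-Tr     : ∀ x → EqFFEL⊢ x ∧● 𝐓 ≈ x
  ax-F1     : ∀ x → EqFFEL⊢ x ∧● 𝐅 ≈ 𝐅 ∧● x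
  ax-F2     : ∀ x → EqFFEL⊢ x ∧● 𝐅 ≈ ¬' x ∧● 𝐅
  ax-F3     : ∀ x y → EqFFEL⊢ (x ∧● 𝐅) ∨● y ≈ (x ∨● 𝐓) ∧● y
  ax-F4     : ∀ x y → EqFFEL⊢ x ∨● (y ∧● 𝐅) ≈ x ∧● (y ∨● 𝐓)
  refl'     : ∀ {s} → EqFFEL⊢ s ≈ s
  sym'      : ∀ {s t} → EqFFEL⊢ s ≈ t → EqFFEL⊢ t ≈ s
  trans'    : ∀ {s t u} → EqFFEL⊢ s ≈ t → EqFFEL⊢ t ≈ u → EqFFEL⊢ s ≈ u
  cong-¬    : ∀ {s t} → EqFFEL⊢ s ≈ t → EqFFEL⊢ ¬' s ≈ ¬' t
  cong-∧    : ∀ {s s' t t'} → EqFFEL⊢ s ≈ s' → EqFFEL⊢ t ≈ t' →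
              EqFFEL⊢ s ∧● t ≈ s' ∧● t'
  cong-∨    : ∀ {s s' t t'} → EqFFEL⊢ s ≈ s' → EqFFEL⊢ t ≈ t' →
              EqFFEL⊢ s ∨● t ≈ s' ∨● t'

-- Both claims are proved by
-- induction on the shape of the term:
--   * base cases:  F = F ∧● F  (via T ∧● F = ¬T ∧● F)  and dually
--     T = T ∨● T  (T ∨● T unfolds to ¬(¬T ∧● ¬T) = ¬(F ∧● F) = ¬F = T);
--   * step cases:  whenever P = P ∧● F, also x ∧● P = (x ∧● P) ∧● F for any
--     term x, by associativity of ∧●; dually, whenever P = P ∨● T, also
--     x ∨● P = (x ∨● P) ∨● T, using associativity of ∨●, which follows from
--     that of ∧● through the De Morgan definition of ∨●.
module Submission where

open import Defs
open import Data.Product using (_×_; _,_)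
open import Relation.Binary.Bundles using (Setoid)
open import Level using (0ℓ)
import Relation.Binary.Reasoning.Setoid as SetoidReasoning

EqFFEL-setoid : Setoid 0ℓ 0ℓ
EqFFEL-setoid = record
  { Carrier       = Term
  ; _≈_           = EqFFEL⊢_≈_
  ; isEquivalence = record { refl = refl' ; sym = sym' ; trans = trans' }
  }

open SetoidReasoning EqFFEL-setoid

F≈F∧F : EqFFEL⊢ 𝐅 ≈ 𝐅 ∧● 𝐅
F≈F∧F = begin
  𝐅          ≈⟨ sym' (ax-Tl 𝐅) ⟩
  𝐓 ∧● 𝐅     ≈⟨ ax-F2 𝐓 ⟩
  ¬' 𝐓 ∧● 𝐅  ≈⟨ cong-∧ (sym' ax-F) refl' ⟩
  𝐅 ∧● 𝐅     ∎

¬F≈T : EqFFEL⊢ ¬' 𝐅 ≈ 𝐓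
¬F≈T = trans' (cong-¬ ax-F) (ax-negneg 𝐓)

T≈T∨T : EqFFEL⊢ 𝐓 ≈ 𝐓 ∨● 𝐓
T≈T∨T = sym' (begin
  𝐓 ∨● 𝐓                ≈⟨ ax-or 𝐓 𝐓 ⟩
  ¬' (¬' 𝐓 ∧● ¬' 𝐓)     ≈⟨ cong-¬ (cong-∧ (sym' ax-F) (sym' ax-F)) ⟩
  ¬' (𝐅 ∧● 𝐅)           ≈⟨ cong-¬ (sym' F≈F∧F) ⟩
  ¬' 𝐅                  ≈⟨ ¬F≈T ⟩
  𝐓                     ∎)

-- Associativity of ∨●, inherited from that of ∧● by De Morgan duality.
∨-assoc : ∀ x y z → EqFFEL⊢ (x ∨● y) ∨● z ≈ x ∨● (y ∨● z)
∨-assoc x y z = begin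
  (x ∨● y) ∨● z                  ≈⟨ ax-or (x ∨● y) z ⟩
  ¬' (¬' (x ∨● y) ∧● ¬' z)       ≈⟨ cong-¬ (cong-∧ ¬x∨y≈¬x∧¬y refl') ⟩
  ¬' ((¬' x ∧● ¬' y) ∧● ¬' z)    ≈⟨ cong-¬ (ax-assoc (¬' x) (¬' y) (¬' z)) ⟩
  ¬' (¬' x ∧● (¬' y ∧● ¬' z))    ≈⟨ cong-¬ (cong-∧ refl' ¬y∧¬z≈¬y∨z) ⟩
  ¬' (¬' x ∧● ¬' (y ∨● z))       ≈⟨ sym' (ax-or x (y ∨● z)) ⟩
  x ∨● (y ∨● z)                  ∎
  where
  ¬x∨y≈¬x∧¬y : EqFFEL⊢ ¬' (x ∨● y) ≈ ¬' x ∧● ¬' y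
  ¬x∨y≈¬x∧¬y = trans' (cong-¬ (ax-or x y)) (ax-negneg _)

  ¬y∧¬z≈¬y∨z : EqFFEL⊢ ¬' y ∧● ¬' z ≈ ¬' (y ∨● z)
  ¬y∧¬z≈¬y∨z = trans' (sym' (ax-negneg _)) (cong-¬ (sym' (ax-or y z)))

∧-prefix-absorbs-F : ∀ x P → EqFFEL⊢ P ≈ P ∧● 𝐅 →
                     EqFFEL⊢ x ∧● P ≈ (x ∧● P) ∧● 𝐅
∧-prefix-absorbs-F x P P≈P∧F = begin
  x ∧● P           ≈⟨ cong-∧ refl' P≈P∧F ⟩
  x ∧● (P ∧● 𝐅)    ≈⟨ sym' (ax-assoc x P 𝐅) ⟩
  (x ∧● P) ∧● 𝐅    ∎

∨-prefix-absorbs-T : ∀ x P → EqFFEL⊢ P ≈ P ∨● 𝐓 →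
                     EqFFEL⊢ x ∨● P ≈ (x ∨● P) ∨● 𝐓
∨-prefix-absorbs-T x P P≈P∨T = begin
  x ∨● P           ≈⟨ cong-∨ refl' P≈P∨T ⟩
  x ∨● (P ∨● 𝐓)    ≈⟨ sym' (∨-assoc x P 𝐓) ⟩
  (x ∨● P) ∨● 𝐓    ∎

F-term-absorbs-F : ∀ P → IsFTerm P → EqFFEL⊢ P ≈ P ∧● 𝐅
F-term-absorbs-F .𝐅             fF               = F≈F∧F
F-term-absorbs-F .(atom a ∧● P) (fAnd a {P} isF) =
  ∧-prefix-absorbs-F (atom a) P (F-term-absorbs-F P isF)

T-term-absorbs-T : ∀ P → IsTTerm P → EqFFEL⊢ P ≈ P ∨● 𝐓
T-term-absorbs-T .𝐓             tT              = T≈T∨T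
T-term-absorbs-T .(atom a ∨● P) (tOr a {P} isT) =
  ∨-prefix-absorbs-T (atom a) P (T-term-absorbs-T P isT)

mainTheorem16 : (PF PT : Term) → IsFTerm PF → IsTTerm PT →
    (EqFFEL⊢ PF ≈ PF ∧● 𝐅) × (EqFFEL⊢ PT ≈ PT ∨● 𝐓)
mainTheorem16 PF PT isF isT = F-term-absorbs-F PF isF , T-term-absorbs-T PT isT
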